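{- Let $T$ be a compressed trie equipped with the table $\mathsf{nav}$ as described in the context, let $pat$ be a nonempty string, and let $t$ be the longest prefix of $pat$ that is represented in $T$. If $|t| = 0$, then $\mathsf{approxFind}(pat)$ returns the root of $T$; otherwise, $\mathsf{approxFind}(pat)$ returns a vertex $v$ of $T$ such that $t$ is a prefix of $v.\mathit{str}$ and either $v.\mathit{par}.\mathit{len} < |t|$ or $v.\mathit{par}.\mathit{par}.\mathit{len} < |t|$.
   Context: $T$ is a compressed trie (Patricia trie) storing a set of strings. For a vertex $v$, $v.\mathit{par}$ is its parent, $v.\mathit{str}$ is the string spelled on the path from the root to $v$, $v.\mathit{len} = |v.\mathit{str}|$, and $v.\mathit{map}$ maps a letter $a$ to the child $u$ of $v$ with $u.\mathit{str}[v.\mathit{len}+1] = a$ (or $\mathbf{nil}$ if there is none). A string is represented in $T$ if it is a prefix of $v.\mathit{str}$ for some vertex $v$. $\mathsf{hash}$ is the Karp–Rabin fingerprint $\mathsf{hash}(w) = \sum_{i=1}^{|w|} w[i]\alpha^{i-1} \bmod \mu$ ($\mu$ a prime, $\alpha$ random); it is assumed that there are no false positives, i.e., distinct strings compared via fingerprints have distinct fingerprints. Let $\mathsf{rst}(x,i) = x \,\&\, \neg(2^i - 1)$ (resetting the $i$ least significant bits of $x$). For each non-root vertex $v$, let $p_v = \mathsf{rst}(v.\mathit{len}, i)$ for the maximal $i$ with $\mathsf{rst}(v.\mathit{len}, i) > v.\mathit{par}.\mathit{len}$, and $h_v = \mathsf{hash}(v.\mathit{str}[1..p_v])$. The hash table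 $\mathsf{nav}$ maps $(p_v, h_v) \mapsto v$ for every non-root vertex $v$ and returns $\mathbf{nil}$ on all other keys. The procedure $\mathsf{approxFind}(pat)$: set $p \gets 0$, $v \gets$ root; for $i = \lceil \log_2 |pat| \rceil$ down to $0$: if $v.\mathit{len} \ge p + 2^i$ then $p \gets p + 2^i$; else if $\mathsf{nav}(p+2^i, \mathsf{hash}(pat[1..p+2^i])) \ne \mathbf{nil}$ then $p \gets p + 2^i$ and $v \gets \mathsf{nav}(p, \mathsf{hash}(pat[1..p]))$. After the loop, if $v.\mathit{map}(pat[v.\mathit{len}+1]) \ne \mathbf{nil}$ then $v \gets v.\mathit{map}(pat[v.\mathit{len}+1])$. Return $v$. Any lookup involving a position of $pat$ beyond $|pat|$ is treated as returning $\mathbf{nil}$. -}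

module Defs where

open import Data.Nat using (ℕ; zero; suc; _+_; _*_; _∸_; _^_; _≤_; _<_; _≤?_; _<?_; NonZero)
open import Data.Nat.Properties using (_≟_; m^n≢0)
open import Data.Nat.DivMod using (_%_)
open import Data.Nat.Logarithm using (⌈log₂_⌉)
open import Data.Nat.Primality using (Prime)
open import Data.Bool using (Bool; true; false; if_then_else_; _∧_)
open import Data.Nat.ListAction using (sum)
open import Data.List using (List; []; _∷_; length; map; concatMap; filter; zipWith; upTo; take; inits; _++_; foldr)
import Data.List.Properties as LP
open import Data.List.Membership.Propositional using (_∈_)
open import Data.List.Relation.Binary.Prefix.Heterogeneous using (Prefix)
open import Data.List.Relation.Binary.Prefix.Heterogeneous.Properties using (prefix?)
open import Data.Maybe using (Maybe; just; nothing)
open import Data.Product using (_×_; _,_; ∃)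
open import Relation.Binary.PropositionalEquality using (_≡_)
open import Relation.Nullary using (does; ¬_)

-- Strings are lists of letters; letters are natural numbers
-- (so that the Karp–Rabin fingerprint can use them as numbers).
-- Positions: the paper's w[i] (1-based) is the (i-1)-th element here.
Str : Set
Str = List ℕ

_≟ˢ_ : (x y : Str) → Relation.Nullary.Dec (x ≡ y)
_≟ˢ_ = LP.≡-dec _≟_

prefixᵇ : Str → Str → Bool
prefixᵇ u w = does (prefix? _≟_ u w)

properPrefixᵇ : Str → Str → Bool
properPrefixᵇ u w = prefixᵇ u w ∧ does (length u <? length w)

at : Str → ℕ → Maybe ℕ
at []      _       = nothing
at (c ∷ w) zero    = just c
at (c ∷ w) (suc i) = at w i

lcp : Str → Str → Str
lcp [] _ = []
lcp (_ ∷ _) [] = []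
lcp (a ∷ x) (b ∷ y) = if does (a ≟ b) then a ∷ lcp x y else []

-- The compressed trie T of a finite set S of strings.
-- Vertices are identified with their strings v.str: the root [],
-- the strings of S, and the branching points lcp(x,y), x,y ∈ S.
-- (The list may contain duplicates; this is harmless.)

vertices : List Str → List Str
vertices S = [] ∷ (S ++ concatMap (λ x → map (lcp x) S) S)

nonRootVertices : List Str → List Str
nonRootVertices S = filter (λ u → 0 <? length u) (vertices S)

longest : List Str → Str
longest = foldr (λ u best → if does (length best <? length u) then u else best) []

-- v.par : the longest vertex string that is a proper prefix of v
-- (for the root this returns the root itself; never used meaningfully)
par : List Str → Str → Str
par S v = longest (filter (λ u → Data.Bool.T? (properPrefixᵇ u v)) (vertices S))
  where import Data.Bool

findᵇ : (Str → Bool) → List Str → Maybe Str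
findᵇ P [] = nothing
findᵇ P (u ∷ us) = if P u then just u else findᵇ P us

childMap : List Str → Str → ℕ → Maybe Str
childMap S v a = findᵇ
  (λ u → does (par S u ≟ˢ v) ∧ does (length v <? length u)
         ∧ does (Data.Maybe.Properties.≡-dec _≟_ (at u (length v)) (just a)))
  (vertices S)
  where import Data.Maybe.Properties

-- rst(x,i) = x & ¬(2^i − 1) = x − (x mod 2^i)

rst : ℕ → ℕ → ℕ
rst x i = x ∸ (_%_ x (2 ^ i) {{m^n≢0 2 i}})

maxRst : ℕ → ℕ → ℕ → ℕ
maxRst x q zero    = x
maxRst x q (suc i) = if does (q <? rst x (suc i)) then rst x (suc i) else maxRst x q i

-- p_v for a non-root vertex v.  For i ≥ v.len we have rst(v.len,i) = 0,
-- so the maximal i with rst(v.len,i) > v.par.len is at most v.len.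
pv : List Str → Str → ℕ
pv S v = maxRst (length v) (length (par S v)) (length v)

hash : (μ α : ℕ) → .{{NonZero μ}} → Str → ℕ
hash μ α w = sum (zipWith (λ c i → c * α ^ i) w (upTo (length w))) % μ

hv : (μ α : ℕ) → .{{NonZero μ}} → List Str → Str → ℕ
hv μ α S v = hash μ α (take (pv S v) v)

nav : (μ α : ℕ) → .{{NonZero μ}} → List Str → ℕ → ℕ → Maybe Str
nav μ α S p h = findᵇ (λ v → does (pv S v ≟ p) ∧ does (hv μ α S v ≟ h)) (nonRootVertices S)

module _ (μ α : ℕ) .{{_ : NonZero μ}} (S : List Str) (pat : Str) where

  step : ℕ → ℕ × Str → ℕ × Str
  step i (p , v) =
    if does (p + 2 ^ i ≤? length v) then (p + 2 ^ i , v)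
    else (if does (p + 2 ^ i ≤? length pat)
          then lookupNav (nav μ α S (p + 2 ^ i) (hash μ α (take (p + 2 ^ i) pat)))
          else (p , v))
    where
    lookupNav : Maybe Str → ℕ × Str
    lookupNav (just u) = (p + 2 ^ i , u)
    lookupNav nothing  = (p , v)

  loop : ℕ → ℕ × Str → ℕ × Str
  loop zero    s = step zero s
  loop (suc i) s = loop i (step (suc i) s)

  finish : Str → Str
  finish v = go (at pat (length v))
    where
    go : Maybe ℕ → Str
    go nothing = v
    go (just a) with childMap S v a
    ... | just u  = u
    ... | nothing = v

  approxFind : Str
  approxFind with loop ⌈log₂ length pat ⌉ (0 , [])
  ... | (_ , v) = finish v

-- No false positives: among all strings whose fingerprints get compared
-- (prefixes of pat and the nav keys v.str[1..p_v]), equal length and equal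
-- fingerprint imply equality.

comparedStrings : List Str → Str → List Str
comparedStrings S pat = inits pat ++ map (λ v → take (pv S v) v) (nonRootVertices S)

NoFalsePositives : (μ α : ℕ) → .{{NonZero μ}} → List Str → Str → Set
NoFalsePositives μ α S pat = ∀ x y → x ∈ comparedStrings S pat → y ∈ comparedStrings S pat →
  length x ≡ length y → hash μ α x ≡ hash μ α y → x ≡ y

Represented : List Str → Str → Set
Represented S w = ∃ λ v → v ∈ vertices S × Prefix _≡_ w v

LongestRepresentedPrefix : List Str → Str → Str → Set
LongestRepresentedPrefix S pat t =
  Prefix _≡_ t pat × Represented S t ×
  (∀ w → Prefix _≡_ w pat → Represented S w → length w ≤ length t)

-- Let u* be the vertex whose incoming edge contains depth |t|, i.e. t ⊑ u* and |par u*| < |t|.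
-- Before the iteration with exponent i the search state (p , v) satisfies: v is a vertex with
-- v ⊑ u*, p ≤ |v| is a multiple of 2^(i+1), and every vertex w on the root path of u* strictly
-- between v and depth |t| has key p_w < p + 2^(i+1).  The key p_w is the multiple of the largest
-- power of two on the edge into w.  So if the lookup at q = p + 2^i misses, a vertex w of key
-- ≥ q cannot exist: the vertex covering depth q would then have key exactly q and be found.  If
-- the lookup hits, the absence of false positives puts the vertex found on the path to u*.  After
-- the last iteration nothing lies strictly between v and depth |t|, so v is u* or its parent, and
-- the final child step returns u* or a child of u*.  If |t| = 0, every lookup and the child step
-- would exhibit a nonempty represented prefix of pat, so the search stays at the root.

module Submission where

open import Defs
open import Data.Bool using (true; false; if_then_else_; T; T?)
open import Data.Empty using (⊥)
open import Data.List using (List; []; _∷_; length; take; _∷ʳ_; map; filter; inits)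
open import Data.List.Membership.Propositional using (_∈_; lose; find)
open import Data.List.Membership.Propositional.Properties
open import Data.List.Properties using (length-++; length-take)
import Data.List.Relation.Binary.Pointwise as Pointwise
open import Data.List.Relation.Binary.Prefix.Heterogeneous using (Prefix; []; _∷_)
open import Data.List.Relation.Binary.Prefix.Heterogeneous.Properties
  using (fromPointwise; toPointwise; length-mono; prefix?)
import Data.List.Relation.Binary.Prefix.Heterogeneous.Properties as Prefix
open import Data.List.Relation.Unary.Any using (here; there)
open import Data.Maybe using (Maybe; just; nothing)
import Data.Maybe.Properties as Maybe
open import Data.Nat
open import Data.Nat.Divisibility
  using (_∣_; _∣0; divides; ∣-refl; ∣-trans; ∣m∣n⇒∣m+n; 1∣_; *-monoʳ-∣; ∣m+n∣m⇒∣n)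
open import Data.Nat.DivMod using (m%n≡m∸m/n*n; m/n*n≤m; m*n/n≡m; /-monoˡ-≤; m<n⇒m%n≡m)
open import Data.Nat.Logarithm using (⌈log₂_⌉)
open import Data.Nat.Logarithm.Core using (⌈log2⌉)
open import Data.Nat.Primality using (Prime)
open import Data.Nat.Properties
open import Data.Product using (∃; ∃₂; _×_; _,_; proj₁; proj₂; map₁)
open import Data.Sum using (_⊎_; inj₁; inj₂)
import Data.Sum as Sum
open import Data.Unit using (tt)
open import Induction.WellFounded using (Acc; acc)
open import Relation.Binary.PropositionalEquality
open import Relation.Nullary using (¬_; Dec; yes; no; does; contradiction)
open import Relation.Nullary.Decidable using (_×-dec_)

private variable A : Set

infix 4 _⊑_
_⊑_ : List A → List A → Set
xs ⊑ ys = Prefix _≡_ xs ys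

⊑-refl : (xs : List A) → xs ⊑ xs
⊑-refl _ = fromPointwise (Pointwise.refl refl)

⊑-trans : {xs ys zs : List A} → xs ⊑ ys → ys ⊑ zs → xs ⊑ zs
⊑-trans = Prefix.trans trans

⊑-antisym : {xs ys : List A} → xs ⊑ ys → length ys ≤ length xs → xs ≡ ys
⊑-antisym p h = Pointwise.Pointwise-≡⇒≡ (toPointwise (≤-antisym (length-mono p) h) p)

⊑-linear : {xs ys zs : List A} → xs ⊑ zs → ys ⊑ zs → length xs ≤ length ys → xs ⊑ ys
⊑-linear [] _ _ = []
⊑-linear (refl ∷ p) (refl ∷ q) (s≤s h) = refl ∷ ⊑-linear p q h

take-⊑ : ∀ n (xs : List A) → take n xs ⊑ xs
take-⊑ zero xs = []
take-⊑ (suc n) [] = []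
take-⊑ (suc n) (x ∷ xs) = refl ∷ take-⊑ n xs

length-take-≤ : ∀ n (xs : List A) → n ≤ length xs → length (take n xs) ≡ n
length-take-≤ n xs h = trans (length-take n xs) (m≤n⇒m⊓n≡m h)

⊑⇒take-length : {xs ys : List A} → xs ⊑ ys → take (length xs) ys ≡ xs
⊑⇒take-length [] = refl
⊑⇒take-length (refl ∷ p) = cong (_ ∷_) (⊑⇒take-length p)

take∈inits : ∀ n (xs : List A) → take n xs ∈ inits xs
take∈inits zero xs = here refl
take∈inits (suc n) [] = here refl
take∈inits (suc n) (x ∷ xs) = there (∈-map⁺ (x ∷_) (take∈inits n xs))

<-length-∷ʳ : ∀ (v : List A) a → length v < length (v ∷ʳ a)
<-length-∷ʳ v a = subst (length v <_) (sym (length-++ v)) (m<m+n (length v) (s≤s z≤n))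

if-does : ∀ {P : Set} {B : Set} (d : Dec P) (x y : B) →
  P × (if does d then x else y) ≡ x ⊎ ¬ P × (if does d then x else y) ≡ y
if-does (yes p) x y = inj₁ (p , refl)
if-does (no ¬p) x y = inj₂ (¬p , refl)

does-sound : ∀ {P : Set} (P? : Dec P) → T (does P?) → P
does-sound (yes p) _ = p

does-complete : ∀ {P : Set} (P? : Dec P) → P → T (does P?)
does-complete (yes _) _ = tt
does-complete (no ¬p) p = ¬p p

≤ᵇ-true⇒≤ : ∀ {m n} → (m ≤ᵇ n) ≡ true → m ≤ n
≤ᵇ-true⇒≤ {m} {n} m≤ᵇn = ≤ᵇ⇒≤ m n (subst T (sym m≤ᵇn) tt)

≤ᵇ-false⇒≰ : ∀ {m n} → (m ≤ᵇ n) ≡ false → ¬ m ≤ n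
≤ᵇ-false⇒≰ m≰ᵇn m≤n = subst T m≰ᵇn (≤⇒≤ᵇ m≤n)

at-⊑ : ∀ {u w} → u ⊑ w → ∀ {n} → n < length u → at w n ≡ at u n
at-⊑ (refl ∷ p) {zero} _ = refl
at-⊑ (refl ∷ p) {suc n} (s≤s h) = at-⊑ p h

at-< : ∀ u {n} → n < length u → at u n ≢ nothing
at-< (a ∷ u) {zero} _ ()
at-< (a ∷ u) {suc n} (s≤s h) = at-< u h

∷ʳ-⊑ : ∀ {v x a} → v ⊑ x → at x (length v) ≡ just a → v ∷ʳ a ⊑ x
∷ʳ-⊑ {x = b ∷ x} [] refl = refl ∷ []
∷ʳ-⊑ (refl ∷ p) e = refl ∷ ∷ʳ-⊑ p e

lcp-∷ : ∀ a b x y → a ≡ b × lcp (a ∷ x) (b ∷ y) ≡ a ∷ lcp x y ⊎ a ≢ b × lcp (a ∷ x) (b ∷ y) ≡ []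
lcp-∷ a b x y = if-does (a ≟ b) (a ∷ lcp x y) []

lcp-⊑ˡ : ∀ x y → lcp x y ⊑ x
lcp-⊑ˡ [] y = []
lcp-⊑ˡ (a ∷ x) [] = []
lcp-⊑ˡ (a ∷ x) (b ∷ y) with lcp-∷ a b x y
... | inj₁ (_ , e) rewrite e = refl ∷ lcp-⊑ˡ x y
... | inj₂ (_ , e) rewrite e = []

lcp-⊑ʳ : ∀ x y → lcp x y ⊑ y
lcp-⊑ʳ [] y = []
lcp-⊑ʳ (a ∷ x) [] = []
lcp-⊑ʳ (a ∷ x) (b ∷ y) with lcp-∷ a b x y
... | inj₁ (refl , e) rewrite e = refl ∷ lcp-⊑ʳ x y
... | inj₂ (_ , e) rewrite e = []

lcp-greatest : ∀ {s x y} → s ⊑ x → s ⊑ y → s ⊑ lcp x y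
lcp-greatest [] _ = []
lcp-greatest {a ∷ _} {_ ∷ x} {_ ∷ y} (refl ∷ p) (refl ∷ q) with lcp-∷ a a x y
... | inj₁ (_ , e) rewrite e = refl ∷ lcp-greatest p q
... | inj₂ (a≢a , _) = contradiction refl a≢a

lcp-self : ∀ x → lcp x x ≡ x
lcp-self x = sym (⊑-antisym (lcp-greatest (⊑-refl x) (⊑-refl x)) (length-mono (lcp-⊑ˡ x x)))

lcp-[]ʳ : ∀ x → lcp x [] ≡ []
lcp-[]ʳ [] = refl
lcp-[]ʳ (_ ∷ _) = refl

lcp-of-prefixes : ∀ {a b x z} → a ⊑ x → b ⊑ z → lcp a b ≡ a ⊎ lcp a b ≡ b ⊎ lcp a b ≡ lcp x z
lcp-of-prefixes [] _ = inj₁ refl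
lcp-of-prefixes (refl ∷ _) [] = inj₂ (inj₁ refl)
lcp-of-prefixes {c ∷ a} {d ∷ b} {_ ∷ x} {_ ∷ z} (refl ∷ p) (refl ∷ q)
  with lcp-∷ c d a b | lcp-∷ c d x z
... | inj₁ (refl , e) | inj₁ (_ , e′) rewrite e | e′ =
  Sum.map (cong (c ∷_)) (Sum.map (cong (c ∷_)) (cong (c ∷_))) (lcp-of-prefixes p q)
... | inj₂ (_ , e) | inj₂ (_ , e′) rewrite e | e′ = inj₂ (inj₂ refl)
... | inj₁ (c≡d , _) | inj₂ (c≢d , _) = contradiction c≡d c≢d
... | inj₂ (c≢d , _) | inj₁ (c≡d , _) = contradiction c≡d c≢d

properPrefixᵇ-sound : ∀ {u w} → T (properPrefixᵇ u w) → u ⊑ w × length u < length w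
properPrefixᵇ-sound {u} {w} = does-sound (prefix? _≟_ u w ×-dec length u <? length w)

properPrefixᵇ-complete : ∀ {u w} → u ⊑ w → length u < length w → T (properPrefixᵇ u w)
properPrefixᵇ-complete {u} {w} u⊑w u<w =
  does-complete (prefix? _≟_ u w ×-dec length u <? length w) (u⊑w , u<w)

findᵇ-sound : ∀ P us {u} → findᵇ P us ≡ just u → u ∈ us × T (P u)
findᵇ-sound P (x ∷ us) e with P x in Px
... | true  =
  subst (λ u → u ∈ x ∷ us × T (P u)) (Maybe.just-injective e) (here refl , subst T (sym Px) tt)
... | false = map₁ there (findᵇ-sound P us e)

findᵇ-complete : ∀ P {us u} → u ∈ us → T (P u) → findᵇ P us ≢ nothing
findᵇ-complete P {x ∷ us} u∈ Pu with P x in Px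
... | true = λ ()
findᵇ-complete P (here refl) Pu | false = λ _ → subst T Px Pu
findᵇ-complete P (there u∈) Pu | false = findᵇ-complete P u∈ Pu

longest-∈ : ∀ us → longest us ≡ [] ⊎ longest us ∈ us
longest-∈ [] = inj₁ refl
longest-∈ (u ∷ us) with if-does (length (longest us) <? length u) u (longest us)
... | inj₁ (_ , e) = inj₂ (subst (_∈ u ∷ us) (sym e) (here refl))
... | inj₂ (_ , e) = Sum.map (trans e) (λ m → subst (_∈ u ∷ us) (sym e) (there m)) (longest-∈ us)

≤-longest : ∀ {u} us → u ∈ us → length u ≤ length (longest us)
≤-longest (v ∷ us) u∈ with if-does (length (longest us) <? length v) v (longest us)
≤-longest (v ∷ us) (here refl) | inj₁ (_ , e) = ≤-reflexive (cong length (sym e))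
≤-longest (v ∷ us) (there u∈)  | inj₁ (lt , e) =
  ≤-trans (≤-longest us u∈) (≤-trans (<⇒≤ lt) (≤-reflexive (cong length (sym e))))
≤-longest (v ∷ us) (here refl) | inj₂ (ge , e) = ≤-trans (≮⇒≥ ge) (≤-reflexive (cong length (sym e)))
≤-longest (v ∷ us) (there u∈)  | inj₂ (_ , e) =
  ≤-trans (≤-longest us u∈) (≤-reflexive (cong length (sym e)))

2^-∣ : ∀ {j k} → j ≤ k → 2 ^ j ∣ 2 ^ k
2^-∣ z≤n = 1∣ _
2^-∣ (s≤s j≤k) = *-monoʳ-∣ 2 (2^-∣ j≤k)

n<2^n : ∀ n → n < 2 ^ n
n<2^n zero = s≤s z≤n
n<2^n (suc n) = subst (_< 2 ^ suc n) (+-identityʳ (suc n))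
  (+-mono-≤-< (n<2^n n) (<-≤-trans (m^n>0 2 n) (m≤m+n (2 ^ n) 0)))

n≤2*⌈n/2⌉ : ∀ n → n ≤ 2 * ⌈ n /2⌉
n≤2*⌈n/2⌉ 0 = z≤n
n≤2*⌈n/2⌉ 1 = s≤s z≤n
n≤2*⌈n/2⌉ (suc (suc n)) = subst (suc (suc n) ≤_) (sym (*-suc 2 ⌈ n /2⌉)) (s≤s (s≤s (n≤2*⌈n/2⌉ n)))

n≤2^⌈log₂n⌉ : ∀ n → n ≤ 2 ^ ⌈log₂ n ⌉
n≤2^⌈log₂n⌉ n = go n _
  where
  go : ∀ n (rec : Acc _<_ n) → n ≤ 2 ^ ⌈log2⌉ n rec
  go 0 _ = z≤n
  go 1 _ = s≤s z≤n
  go (suc (suc n)) (acc rs) =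
    ≤-trans (n≤2*⌈n/2⌉ (suc (suc n))) (*-monoʳ-≤ 2 (go (suc ⌈ n /2⌉) (rs (⌈n/2⌉<n n))))

∣-2^-pred : ∀ i {p} → 2 ^ suc i ∣ p → 2 ^ i ∣ p
∣-2^-pred i = ∣-trans (2^-∣ (n≤1+n i))

∣-+2^ : ∀ i {p} → 2 ^ suc i ∣ p → 2 ^ i ∣ p + 2 ^ i
∣-+2^ i 2^i+1∣p = ∣m∣n⇒∣m+n (∣-2^-pred i 2^i+1∣p) ∣-refl

+-2^-suc : ∀ p i → p + 2 ^ suc i ≡ p + 2 ^ i + 2 ^ i
+-2^-suc p i =
  trans (cong (λ n → p + (2 ^ i + n)) (+-identityʳ (2 ^ i))) (sym (+-assoc p (2 ^ i) (2 ^ i)))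

∣-below-double : ∀ {n m} → n ∣ m → 0 < m → m < 2 * n → m ≡ n
∣-below-double (divides 0 refl) () _
∣-below-double {n} (divides 1 refl) _ _ = +-identityʳ n
∣-below-double {n} (divides (suc (suc k)) refl) _ m<2n =
  contradiction m<2n (≤⇒≯ (+-monoʳ-≤ n (+-monoʳ-≤ n z≤n)))

2^-midpoint : ∀ i {p y} → 2 ^ suc i ∣ p → 2 ^ i ∣ y → p < y → y < p + 2 ^ suc i → y ≡ p + 2 ^ i
2^-midpoint i {p} {y} 2^i+1∣p 2^i∣y p<y y<p+2^i+1 = begin
  y               ≡⟨ sym (m+[n∸m]≡n (<⇒≤ p<y)) ⟩
  p + (y ∸ p)     ≡⟨ cong (p +_) (∣-below-double 2^i∣y∸p (m<n⇒0<n∸m p<y) y∸p<2^i+1) ⟩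
  p + 2 ^ i       ∎
  where
  open ≡-Reasoning
  2^i∣y∸p : 2 ^ i ∣ y ∸ p
  2^i∣y∸p = ∣m+n∣m⇒∣n (subst (2 ^ i ∣_) (sym (m+[n∸m]≡n (<⇒≤ p<y))) 2^i∣y) (∣-2^-pred i 2^i+1∣p)
  y∸p<2^i+1 : y ∸ p < 2 ^ suc i
  y∸p<2^i+1 = m<n+o⇒m∸n<o y p {{m^n≢0 2 (suc i)}} y<p+2^i+1

m∸m%n≡m/n*n : ∀ m n .{{_ : NonZero n}} → m ∸ m % n ≡ m / n * n
m∸m%n≡m/n*n m n = trans (cong (m ∸_) (m%n≡m∸m/n*n m n)) (m∸[m∸n]≡n (m/n*n≤m m n))

module _ (i : ℕ) where
  private instance
    2^i≢0 : NonZero (2 ^ i)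
    2^i≢0 = m^n≢0 2 i

  rst-≤ : ∀ x → rst x i ≤ x
  rst-≤ x = m∸n≤m x (x % 2 ^ i)

  rst-∣ : ∀ x → 2 ^ i ∣ rst x i
  rst-∣ x = divides (x / 2 ^ i) (m∸m%n≡m/n*n x (2 ^ i))

  rst-greatest : ∀ {q x} → q ≤ x → 2 ^ i ∣ q → q ≤ rst x i
  rst-greatest {x = x} q≤x (divides d refl) =
    subst (d * 2 ^ i ≤_) (sym (m∸m%n≡m/n*n x (2 ^ i))) (*-monoˡ-≤ (2 ^ i) d≤x/2^i)
    where
    d≤x/2^i : d ≤ x / 2 ^ i
    d≤x/2^i = subst (_≤ x / 2 ^ i) (m*n/n≡m d (2 ^ i)) (/-monoˡ-≤ (2 ^ i) q≤x)

  rst-< : ∀ {x} → x < 2 ^ i → rst x i ≡ 0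
  rst-< {x} x<2^i = trans (cong (x ∸_) (m<n⇒m%n≡m x<2^i)) (n∸n≡0 x)

maxRst-≤ : ∀ x q k → maxRst x q k ≤ x
maxRst-≤ x q zero = ≤-refl
maxRst-≤ x q (suc k) with if-does (q <? rst x (suc k)) (rst x (suc k)) (maxRst x q k)
... | inj₁ (_ , e) = subst (_≤ x) (sym e) (rst-≤ (suc k) x)
... | inj₂ (_ , e) = subst (_≤ x) (sym e) (maxRst-≤ x q k)

maxRst-> : ∀ x q k → q < x → q < maxRst x q k
maxRst-> x q zero q<x = q<x
maxRst-> x q (suc k) q<x with if-does (q <? rst x (suc k)) (rst x (suc k)) (maxRst x q k)
... | inj₁ (q<rst , e) = subst (q <_) (sym e) q<rst
... | inj₂ (_ , e) = subst (q <_) (sym e) (maxRst-> x q k q<x)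

maxRst-∣ : ∀ x q k {j} → j ≤ k → q < rst x j → 2 ^ j ∣ maxRst x q k
maxRst-∣ x q zero z≤n _ = 1∣ x
maxRst-∣ x q (suc k) {j} j≤k q<rst with if-does (q <? rst x (suc k)) (rst x (suc k)) (maxRst x q k)
... | inj₁ (_ , e) = subst (2 ^ j ∣_) (sym e) (∣-trans (2^-∣ j≤k) (rst-∣ (suc k) x))
... | inj₂ (q≮rst , e) with m≤n⇒m<n∨m≡n j≤k
...   | inj₁ j<1+k = subst (2 ^ j ∣_) (sym e) (maxRst-∣ x q k (≤-pred j<1+k) q<rst)
...   | inj₂ refl = contradiction q<rst q≮rst

module Trie (S : List Str) where

  []∈V : [] ∈ vertices S
  []∈V = here refl

  lcp-∈V-from-S : ∀ {x y} → x ∈ S → y ∈ S → lcp x y ∈ vertices S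
  lcp-∈V-from-S {x} {y} x∈ y∈ =
    there (∈-++⁺ʳ S (∈-concatMap⁺ (λ x → map (lcp x) S) (lose x∈ (∈-map⁺ (lcp x) y∈))))

  ∈V⇒lcp : ∀ {w} → w ∈ vertices S → w ≡ [] ⊎ ∃₂ λ x y → x ∈ S × y ∈ S × w ≡ lcp x y
  ∈V⇒lcp (here refl) = inj₁ refl
  ∈V⇒lcp {w} (there w∈) with ∈-++⁻ S w∈
  ... | inj₁ w∈S = inj₂ (w , w , w∈S , w∈S , sym (lcp-self w))
  ... | inj₂ w∈lcps with find (∈-concatMap⁻ (λ x → map (lcp x) S) w∈lcps)
  ... | x , x∈ , w∈map with ∈-map⁻ (lcp x) w∈map
  ... | y , y∈ , w≡ = inj₂ (x , y , x∈ , y∈ , w≡)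

  vertices-lcp-closed : ∀ {a b} → a ∈ vertices S → b ∈ vertices S → lcp a b ∈ vertices S
  vertices-lcp-closed {a} {b} a∈ b∈ with ∈V⇒lcp a∈ | ∈V⇒lcp b∈
  ... | inj₁ refl | _ = []∈V
  ... | inj₂ _ | inj₁ refl = subst (_∈ vertices S) (sym (lcp-[]ʳ a)) []∈V
  ... | inj₂ (x , y , x∈ , _ , refl) | inj₂ (z , w , z∈ , _ , refl)
      with lcp-of-prefixes (lcp-⊑ˡ x y) (lcp-⊑ˡ z w)
  ... | inj₁ e = subst (_∈ vertices S) (sym e) a∈
  ... | inj₂ (inj₁ e) = subst (_∈ vertices S) (sym e) b∈
  ... | inj₂ (inj₂ e) = subst (_∈ vertices S) (sym e) (lcp-∈V-from-S x∈ z∈)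

  private
    ProperAncestors : Str → List Str
    ProperAncestors w = filter (λ u → T? (properPrefixᵇ u w)) (vertices S)

  par-root-or-proper : ∀ w →
    par S w ≡ [] ⊎ par S w ∈ vertices S × par S w ⊑ w × length (par S w) < length w
  par-root-or-proper w = Sum.map₂ proper (longest-∈ (ProperAncestors w))
    where
    proper : par S w ∈ ProperAncestors w → _
    proper p∈ with ∈-filter⁻ (λ u → T? (properPrefixᵇ u w)) {xs = vertices S} p∈
    ... | p∈V , pp = p∈V , properPrefixᵇ-sound pp

  par-∈V : ∀ w → par S w ∈ vertices S
  par-∈V w with par-root-or-proper w
  ... | inj₁ e = subst (_∈ vertices S) (sym e) []∈V
  ... | inj₂ (p∈ , _) = p∈

  par-⊑ : ∀ w → par S w ⊑ w
  par-⊑ w with par-root-or-proper w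
  ... | inj₁ e = subst (_⊑ w) (sym e) []
  ... | inj₂ (_ , p⊑w , _) = p⊑w

  par-< : ∀ w → 0 < length w → length (par S w) < length w
  par-< w 0<w with par-root-or-proper w
  ... | inj₁ e = subst (λ p → length p < length w) (sym e) 0<w
  ... | inj₂ (_ , _ , p<w) = p<w

  ≤-par : ∀ {u w} → u ∈ vertices S → u ⊑ w → length u < length w → length u ≤ length (par S w)
  ≤-par {u} {w} u∈ u⊑w u<w =
    ≤-longest (ProperAncestors w)
      (∈-filter⁺ (λ u → T? (properPrefixᵇ u w)) u∈ (properPrefixᵇ-complete u⊑w u<w))

  ≤-par-on-path : ∀ {a b c} → a ∈ vertices S → a ⊑ c → b ⊑ c → length a < length b →
                  length a ≤ length (par S b)
  ≤-par-on-path a∈ a⊑c b⊑c a<b = ≤-par a∈ (⊑-linear a⊑c b⊑c (<⇒≤ a<b)) a<b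

  -- lcp w y is a vertex that is a prefix of w, too long to be a proper one.
  ancestor-of-common-prefix : ∀ {s w y} → w ∈ vertices S → y ∈ vertices S → s ⊑ w → s ⊑ y →
                              length (par S w) < length s → w ⊑ y
  ancestor-of-common-prefix {s} {w} {y} w∈ y∈ s⊑w s⊑y par<s with length (lcp w y) <? length w
  ... | yes lcp<w = contradiction (≤-par (vertices-lcp-closed w∈ y∈) (lcp-⊑ˡ w y) lcp<w)
                      (<⇒≱ (<-≤-trans par<s (length-mono (lcp-greatest s⊑w s⊑y))))
  ... | no lcp≮w = subst (_⊑ y) (⊑-antisym (lcp-⊑ˡ w y) (≮⇒≥ lcp≮w)) (lcp-⊑ʳ w y)

  children-unique : ∀ {u u′ v a} → u ∈ vertices S → u′ ∈ vertices S → par S u ≡ v → par S u′ ≡ v →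
                    at u (length v) ≡ just a → at u′ (length v) ≡ just a → u ≡ u′
  children-unique {u} {u′} {v} {a} u∈ u′∈ refl par-u′ u[v] u′[v] =
    ⊑-antisym (ancestor-of-common-prefix u∈ u′∈ va⊑u va⊑u′ (<-length-∷ʳ v a))
              (length-mono (ancestor-of-common-prefix u′∈ u∈ va⊑u′ va⊑u
                             (subst (λ p → length p < length (v ∷ʳ a)) (sym par-u′) (<-length-∷ʳ v a))))
    where
    va⊑u : v ∷ʳ a ⊑ u
    va⊑u = ∷ʳ-⊑ (par-⊑ u) u[v]
    va⊑u′ : v ∷ʳ a ⊑ u′
    va⊑u′ = ∷ʳ-⊑ (subst (_⊑ u′) par-u′ (par-⊑ u′)) u′[v]

  _Covers_ : Str → ℕ → Set
  w Covers q = length (par S w) < q × q ≤ length w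

  covering-ancestor : ∀ {q x} → x ∈ vertices S → 0 < q → q ≤ length x →
                      ∃ λ w → w ∈ vertices S × w ⊑ x × w Covers q
  covering-ancestor {q} {x} x∈ 0<q q≤x = go (length x) ≤-refl x∈ q≤x
    where
    go : ∀ n {x} → length x ≤ n → x ∈ vertices S → q ≤ length x →
         ∃ λ w → w ∈ vertices S × w ⊑ x × w Covers q
    go zero x≤0 _ q≤x = contradiction (≤-trans q≤x x≤0) (<⇒≱ 0<q)
    go (suc n) {x} x≤n x∈ q≤x with length (par S x) <? q
    ... | yes par<q = x , x∈ , ⊑-refl x , par<q , q≤x
    ... | no par≮q
        with go n (≤-pred (≤-trans (par-< x (<-≤-trans 0<q q≤x)) x≤n)) (par-∈V x) (≮⇒≥ par≮q)
    ...   | w , w∈ , w⊑par , covers = w , w∈ , ⊑-trans w⊑par (par-⊑ x) , covers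

  pv-≤ : ∀ w → pv S w ≤ length w
  pv-≤ w = maxRst-≤ (length w) (length (par S w)) (length w)

  par-<-pv : ∀ w → 0 < length w → length (par S w) < pv S w
  par-<-pv w 0<w = maxRst-> (length w) (length (par S w)) (length w) (par-< w 0<w)

  pv-∣ : ∀ w {q i} → w Covers q → 2 ^ i ∣ q → 2 ^ i ∣ pv S w
  pv-∣ w {q} {i} (par<q , q≤w) 2^i∣q with i ≤? length w
  ... | yes i≤w = maxRst-∣ (length w) (length (par S w)) (length w) i≤w
                    (<-≤-trans par<q (rst-greatest i q≤w 2^i∣q))
  ... | no i≰w = contradiction (rst-greatest i q≤w 2^i∣q)
                   (subst (q ≰_) (sym (rst-< i (<-trans (≰⇒> i≰w) (n<2^n i)))) (<⇒≱ (≤-<-trans z≤n par<q)))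

  private
    child? : ∀ v a u → Dec (par S u ≡ v × length v < length u × at u (length v) ≡ just a)
    child? v a u = par S u ≟ˢ v ×-dec length v <? length u ×-dec Maybe.≡-dec _≟_ (at u (length v)) (just a)

  childMap-sound : ∀ {v a u} → childMap S v a ≡ just u →
                   u ∈ vertices S × par S u ≡ v × length v < length u × at u (length v) ≡ just a
  childMap-sound {v} {a} {u} e with findᵇ-sound _ (vertices S) e
  ... | u∈ , isChild = u∈ , does-sound (child? v a u) isChild

  childMap-complete : ∀ {v a u} → u ∈ vertices S → par S u ≡ v → length v < length u →
                      at u (length v) ≡ just a → childMap S v a ≢ nothing
  childMap-complete {v} {a} {u} u∈ par-u v<u u[v] =
    findᵇ-complete _ u∈ (does-complete (child? v a u) (par-u , v<u , u[v]))

module Search (μ α : ℕ) .{{_ : NonZero μ}} (S : List Str) (pat : Str) where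
  open Trie S

  navAt : ℕ → Maybe Str
  navAt q = nav μ α S q (hash μ α (take q pat))

  data StepView (i p : ℕ) (v : Str) : ℕ × Str → Set where
    descend : p + 2 ^ i ≤ length v → StepView i p v (p + 2 ^ i , v)
    jump    : ∀ {u} → length v < p + 2 ^ i → p + 2 ^ i ≤ length pat → navAt (p + 2 ^ i) ≡ just u →
              StepView i p v (p + 2 ^ i , u)
    stay    : length v < p + 2 ^ i → (p + 2 ^ i ≤ length pat → navAt (p + 2 ^ i) ≡ nothing) →
              StepView i p v (p , v)

  step-view : ∀ i p v → StepView i p v (step μ α S pat i (p , v))
  step-view i p v
    with p + 2 ^ i ≤ᵇ length v in q≤v | p + 2 ^ i ≤ᵇ length pat in q≤pat | navAt (p + 2 ^ i) in hit
  ... | true  | _     | _       = descend (≤ᵇ-true⇒≤ q≤v)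
  ... | false | true  | just u  = jump (≰⇒> (≤ᵇ-false⇒≰ q≤v)) (≤ᵇ-true⇒≤ q≤pat) hit
  ... | false | true  | nothing = stay (≰⇒> (≤ᵇ-false⇒≰ q≤v)) (λ _ → hit)
  ... | false | false | _       =
    stay (≰⇒> (≤ᵇ-false⇒≰ q≤v)) (λ q≤pat′ → contradiction q≤pat′ (≤ᵇ-false⇒≰ q≤pat))

  data FinishView (v : Str) : Str → Set where
    end      : at pat (length v) ≡ nothing → FinishView v v
    no-child : ∀ {a} → at pat (length v) ≡ just a → childMap S v a ≡ nothing → FinishView v v
    child    : ∀ {a u} → at pat (length v) ≡ just a → childMap S v a ≡ just u → FinishView v u

  finish-view : ∀ v → FinishView v (finish μ α S pat v)
  finish-view v with at pat (length v) in pat[v]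
  ... | nothing = end pat[v]
  ... | just a with childMap S v a in next
  ...   | nothing = no-child pat[v] next
  ...   | just u  = child pat[v] next

  K : ℕ
  K = ⌈log₂ length pat ⌉

  approxFind-finish : approxFind μ α S pat ≡ finish μ α S pat (proj₂ (loop μ α S pat K (0 , [])))
  approxFind-finish with loop μ α S pat K (0 , [])
  ... | _ , v = refl

  loop-preserves : (I : ℕ → ℕ × Str → Set) → (∀ i s → I (suc i) s → I i (step μ α S pat i s)) →
                   ∀ k s → I (suc k) s → I 0 (loop μ α S pat k s)
  loop-preserves I pres zero    s Is = pres zero s Is
  loop-preserves I pres (suc k) s Is =
    loop-preserves I pres k (step μ α S pat (suc k) s) (pres (suc k) s Is)

  nav-sound : NoFalsePositives μ α S pat → ∀ {q u} → q ≤ length pat → navAt q ≡ just u →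
              u ∈ vertices S × 0 < length u × pv S u ≡ q × take q pat ⊑ u
  nav-sound nfp {q} {u} q≤pat hit with findᵇ-sound _ (nonRootVertices S) hit
  ... | u∈ , isKey with ∈-filter⁻ (λ u → 0 <? length u) {xs = vertices S} u∈
                      | does-sound (pv S u ≟ q ×-dec hv μ α S u ≟ hash μ α (take q pat)) isKey
  ...   | u∈V , 0<u | pv≡q , same-hash = u∈V , 0<u , pv≡q , subst (_⊑ u) key≡ (take-⊑ (pv S u) u)
    where
    key≡ : take (pv S u) u ≡ take q pat
    key≡ = nfp _ _ (∈-++⁺ʳ (inits pat) (∈-map⁺ (λ v → take (pv S v) v) u∈)) (∈-++⁺ˡ (take∈inits q pat))
      (trans (length-take-≤ (pv S u) u (pv-≤ u)) (trans pv≡q (sym (length-take-≤ q pat q≤pat))))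
      same-hash

  nav-complete : ∀ {q w} → w ∈ vertices S → 0 < length w → pv S w ≡ q → take q w ≡ take q pat →
                 navAt q ≢ nothing
  nav-complete {q} {w} w∈ 0<w refl same =
    findᵇ-complete _ (∈-filter⁺ (λ u → 0 <? length u) w∈ 0<w)
      (does-complete (pv S w ≟ q ×-dec hv μ α S w ≟ hash μ α (take q pat)) (refl , cong (hash μ α) same))

module Correctness (μ α : ℕ) .{{_ : NonZero μ}} (S : List Str) (pat : Str)
                   (nfp : NoFalsePositives μ α S pat)
                   (t : Str) (t-longest : LongestRepresentedPrefix S pat t) where
  open Trie S
  open Search μ α S pat

  t⊑pat : t ⊑ pat
  t⊑pat = proj₁ t-longest

  represented-≤-t : ∀ {w u} → w ⊑ pat → u ∈ vertices S → w ⊑ u → length w ≤ length t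
  represented-≤-t w⊑pat u∈ w⊑u = proj₂ (proj₂ t-longest) _ w⊑pat (_ , u∈ , w⊑u)

  nav-hit-≤-t : ∀ {q u} → q ≤ length pat → navAt q ≡ just u → q ≤ length t
  nav-hit-≤-t {q} q≤pat hit with nav-sound nfp q≤pat hit
  ... | u∈ , _ , _ , take-pat-⊑u =
    subst (_≤ length t) (length-take-≤ q pat q≤pat) (represented-≤-t (take-⊑ q pat) u∈ take-pat-⊑u)

  0<p+2^i : ∀ p i → 0 < p + 2 ^ i
  0<p+2^i p i = <-≤-trans (m^n>0 2 i) (m≤n+m (2 ^ i) p)

  approxFind-root : length t ≡ 0 → approxFind μ α S pat ≡ []
  approxFind-root t≡0 =
    trans approxFind-finish
      (finish-root (loop-preserves (λ _ s → proj₂ s ≡ []) stays-at-root K (0 , []) refl))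
    where
    stays-at-root : ∀ i s → proj₂ s ≡ [] → proj₂ (step μ α S pat i s) ≡ []
    stays-at-root i (p , v) refl with step μ α S pat i (p , []) | step-view i p []
    ... | _ | descend q≤0 = contradiction q≤0 (<⇒≱ (0<p+2^i p i))
    ... | _ | jump _ q≤pat hit =
      contradiction (subst (p + 2 ^ i ≤_) t≡0 (nav-hit-≤-t q≤pat hit)) (<⇒≱ (0<p+2^i p i))
    ... | _ | stay _ _ = refl

    finish-root : ∀ {v} → v ≡ [] → finish μ α S pat v ≡ []
    finish-root refl with finish μ α S pat [] | finish-view []
    ... | _ | end _ = refl
    ... | _ | no-child _ _ = refl
    ... | _ | child pat[0] next with childMap-sound next
    ...   | u∈ , _ , _ , u[0] =
      contradiction (subst (1 ≤_) t≡0 (represented-≤-t (∷ʳ-⊑ [] pat[0]) u∈ (∷ʳ-⊑ [] u[0]))) (λ ())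

  Found : Str → Set
  Found r = r ∈ vertices S × t ⊑ r ×
            (length (par S r) < length t ⊎ length (par S (par S r)) < length t)

  module Locus (u* : Str) (u*∈ : u* ∈ vertices S) (t⊑u* : t ⊑ u*)
               (par-u*<t : length (par S u*) < length t) where

    KeysBelow : ℕ → Str → ℕ → Set
    KeysBelow p v m = ∀ w → w ∈ vertices S → w ⊑ u* → length v < length w → length w < length t →
                      pv S w < p + m

    -- Invariant (suc i) holds before the iteration with exponent i.
    Invariant : ℕ → ℕ × Str → Set
    Invariant e (p , v) = v ∈ vertices S × v ⊑ u* × p ≤ length v × 2 ^ e ∣ p × KeysBelow p v (2 ^ e)

    take-pat-⊑u* : ∀ {q} → q ≤ length t → take q pat ⊑ u*
    take-pat-⊑u* {q} q≤t = ⊑-trans (⊑-linear (take-⊑ q pat) t⊑pat |take|≤t) t⊑u*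
      where
      |take|≤t : length (take q pat) ≤ length t
      |take|≤t = ≤-trans (≤-reflexive (length-take q pat)) (≤-trans (m⊓n≤m q (length pat)) q≤t)

    initial : Invariant (suc K) (0 , [])
    initial = []∈V , [] , z≤n , (2 ^ suc K) ∣0 , λ w _ _ _ w<t →
      ≤-trans (≤-<-trans (pv-≤ w) (<-≤-trans w<t t≤2^K)) (m≤m+n (2 ^ K) (2 ^ K + 0))
      where
      t≤2^K : length t ≤ 2 ^ K
      t≤2^K = ≤-trans (length-mono t⊑pat) (n≤2^⌈log₂n⌉ (length pat))

    covering-key : ∀ {i p v w} → Invariant (suc i) (p , v) → length v < p + 2 ^ i →
                   w ∈ vertices S → w ⊑ u* → w Covers (p + 2 ^ i) → length w < length t →
                   pv S w ≡ p + 2 ^ i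
    covering-key {i} {p} {v} {w} (v∈ , v⊑u* , p≤v , 2^i+1∣p , below) v<q w∈ w⊑u* covers w<t =
      2^-midpoint i 2^i+1∣p (pv-∣ w {i = i} covers 2^i∣q) p<pv (below w w∈ w⊑u* v<w w<t)
      where
      v<w : length v < length w
      v<w = <-≤-trans v<q (proj₂ covers)
      2^i∣q : 2 ^ i ∣ p + 2 ^ i
      2^i∣q = ∣-+2^ i 2^i+1∣p
      p<pv : p < pv S w
      p<pv = ≤-<-trans (≤-trans p≤v (≤-par-on-path v∈ v⊑u* w⊑u* v<w)) (par-<-pv w (≤-<-trans z≤n v<w))

    miss⇒keys-below : ∀ {i p v} → Invariant (suc i) (p , v) → length v < p + 2 ^ i →
                      (p + 2 ^ i ≤ length pat → navAt (p + 2 ^ i) ≡ nothing) → KeysBelow p v (2 ^ i)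
    miss⇒keys-below {i} {p} {v} inv v<q miss w w∈ w⊑u* v<w w<t with pv S w <? p + 2 ^ i
    ... | yes pv<q = pv<q
    ... | no pv≮q with covering-ancestor w∈ (0<p+2^i p i) (≤-trans (≮⇒≥ pv≮q) (pv-≤ w))
    ...   | w′ , w′∈ , w′⊑w , covers@(_ , q≤w′) =
      contradiction (miss q≤pat) (nav-complete w′∈ (<-≤-trans (0<p+2^i p i) q≤w′) key same-prefix)
      where
      q = p + 2 ^ i
      w′<t : length w′ < length t
      w′<t = ≤-<-trans (length-mono w′⊑w) w<t
      q≤t : q ≤ length t
      q≤t = ≤-trans q≤w′ (<⇒≤ w′<t)
      q≤pat : q ≤ length pat
      q≤pat = ≤-trans q≤t (length-mono t⊑pat)
      w′⊑u* : w′ ⊑ u*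
      w′⊑u* = ⊑-trans w′⊑w w⊑u*
      key : pv S w′ ≡ q
      key = covering-key {i} inv v<q w′∈ w′⊑u* covers w′<t
      |take|≡q : length (take q pat) ≡ q
      |take|≡q = length-take-≤ q pat q≤pat
      same-prefix : take q w′ ≡ take q pat
      same-prefix = subst (λ n → take n w′ ≡ take q pat) |take|≡q
        (⊑⇒take-length (⊑-linear (take-pat-⊑u* q≤t) w′⊑u* (≤-trans (≤-reflexive |take|≡q) q≤w′)))

    preserves : ∀ i s → Invariant (suc i) s → Invariant i (step μ α S pat i s)
    preserves i (p , v) inv@(v∈ , v⊑u* , p≤v , 2^i+1∣p , below)
      with step μ α S pat i (p , v) | step-view i p v
    ... | _ | descend q≤v = v∈ , v⊑u* , q≤v , ∣-+2^ i 2^i+1∣p ,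
      λ w w∈ w⊑u* v<w w<t → subst (pv S w <_) (+-2^-suc p i) (below w w∈ w⊑u* v<w w<t)
    ... | _ | stay v<q miss = v∈ , v⊑u* , p≤v , ∣-2^-pred i 2^i+1∣p , miss⇒keys-below {i} inv v<q miss
    ... | _ | jump {u} v<q q≤pat hit with nav-sound nfp q≤pat hit
    ...   | u∈ , 0<u , pv≡q , take-pat-⊑u = u∈ , u⊑u* , q≤u , ∣-+2^ i 2^i+1∣p ,
      λ w w∈ w⊑u* u<w w<t →
        subst (pv S w <_) (+-2^-suc p i) (below w w∈ w⊑u* (<-≤-trans v<q (≤-trans q≤u (<⇒≤ u<w))) w<t)
      where
      q = p + 2 ^ i
      q≤u : q ≤ length u
      q≤u = subst (_≤ length u) pv≡q (pv-≤ u)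
      u⊑u* : u ⊑ u*
      u⊑u* = ancestor-of-common-prefix u∈ u*∈ take-pat-⊑u (take-pat-⊑u* (nav-hit-≤-t q≤pat hit))
        (subst (length (par S u) <_) (trans pv≡q (sym (length-take-≤ q pat q≤pat))) (par-<-pv u 0<u))

    NothingBetween : Str → Set
    NothingBetween v = ∀ w → w ∈ vertices S → w ⊑ u* → length v < length w → length w < length t → ⊥

    nothing-between : ∀ s → Invariant 0 s → NothingBetween (proj₂ s)
    nothing-between (p , v) (v∈ , v⊑u* , p≤v , _ , below) w w∈ w⊑u* v<w w<t =
      <⇒≱ (par-<-pv w (≤-<-trans z≤n v<w))
          (≤-trans (≤-pred (subst (pv S w <_) (+-comm p 1) (below w w∈ w⊑u* v<w w<t)))
                   (≤-trans p≤v (≤-par-on-path v∈ v⊑u* w⊑u* v<w)))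

    u*-found : Found u*
    u*-found = u*∈ , t⊑u* , inj₁ par-u*<t

    finish-at-u* : Found (finish μ α S pat u*)
    finish-at-u* with finish μ α S pat u* | finish-view u*
    ... | _ | end _ = u*-found
    ... | _ | no-child _ _ = u*-found
    ... | _ | child _ next with childMap-sound next
    ...   | c∈ , refl , _ = c∈ , ⊑-trans t⊑u* (par-⊑ _) , inj₂ par-u*<t

    pat≈u* : at pat (length (par S u*)) ≡ at u* (length (par S u*))
    pat≈u* = trans (at-⊑ t⊑pat par-u*<t) (sym (at-⊑ t⊑u* par-u*<t))

    finish-at-par-u* : Found (finish μ α S pat (par S u*))
    finish-at-par-u* with finish μ α S pat (par S u*) | finish-view (par S u*)
    ... | _ | end pat[n]≡nothing =
      contradiction pat[n]≡nothing (at-< pat (<-≤-trans par-u*<t (length-mono t⊑pat)))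
    ... | _ | no-child pat[n] next =
      contradiction next
        (childMap-complete u*∈ refl (<-≤-trans par-u*<t (length-mono t⊑u*))
                           (trans (sym pat≈u*) pat[n]))
    ... | _ | child pat[n] next with childMap-sound next
    ...   | c∈ , par-c , _ , c[n] =
      subst Found (children-unique u*∈ c∈ refl par-c (trans (sym pat≈u*) pat[n]) c[n]) u*-found

    finish-correct : ∀ {v} → v ∈ vertices S → v ⊑ u* → NothingBetween v → Found (finish μ α S pat v)
    finish-correct {v} v∈ v⊑u* between with length t ≤? length v
    ... | yes t≤v = subst (λ v → Found (finish μ α S pat v)) (sym v≡u*) finish-at-u*
      where
      v≡u* : v ≡ u*
      v≡u* = ⊑-antisym v⊑u* (≮⇒≥ λ v<u* → <⇒≱ par-u*<t (≤-trans t≤v (≤-par v∈ v⊑u* v<u*)))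
    ... | no t≰v = subst (λ v → Found (finish μ α S pat v)) (sym v≡par-u*) finish-at-par-u*
      where
      v≤par-u* : length v ≤ length (par S u*)
      v≤par-u* = ≤-par v∈ v⊑u* (<-≤-trans (≰⇒> t≰v) (length-mono t⊑u*))
      v≡par-u* : v ≡ par S u*
      v≡par-u* = ⊑-antisym (⊑-linear v⊑u* (par-⊑ u*) v≤par-u*)
                           (≮⇒≥ λ v<par → between (par S u*) (par-∈V u*) (par-⊑ u*) v<par par-u*<t)

    approxFind-correct : Found (approxFind μ α S pat)
    approxFind-correct = subst Found (sym approxFind-finish)
      (finish-correct (proj₁ inv) (proj₁ (proj₂ inv)) (nothing-between s inv))
      where
      s = loop μ α S pat K (0 , [])
      inv : Invariant 0 s
      inv = loop-preserves Invariant preserves K (0 , []) initial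

  approxFind-found : length t ≢ 0 → Found (approxFind μ α S pat)
  approxFind-found t≢0 with proj₁ (proj₂ t-longest)
  ... | x , x∈ , t⊑x with covering-ancestor x∈ (n≢0⇒n>0 t≢0) (length-mono t⊑x)
  ...   | u* , u*∈ , u*⊑x , par-u*<t , t≤u* =
    Locus.approxFind-correct u* u*∈ (⊑-linear t⊑x u*⊑x t≤u*) par-u*<t

lemma5 : (μ α : ℕ) .{{_ : NonZero μ}} → Prime μ →
    (S : List Str) (pat : Str) → pat ≢ [] →
    NoFalsePositives μ α S pat →
    (t : Str) → LongestRepresentedPrefix S pat t →
    (length t ≡ 0 → approxFind μ α S pat ≡ [])
    × (length t ≢ 0 →
        approxFind μ α S pat ∈ vertices S
        × Prefix _≡_ t (approxFind μ α S pat)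
        × (length (par S (approxFind μ α S pat)) < length t
           ⊎ length (par S (par S (approxFind μ α S pat))) < length t))
lemma5 μ α _ S pat _ nfp t t-longest = approxFind-root , approxFind-found
  where open Correctness μ α S pat nfp t t-longest
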